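{- Let $q$ be an odd prime power with $q\equiv 2\pmod 3$, let $G=\mathrm{PSL}(2,q)$, and let $h\in G$ be the image of the matrix $\begin{bmatrix}0&-1\\1&-1\end{bmatrix}$. Let $\mathcal C_3$ be the set of elements of order $3$ of $G$ and let $\Gamma$ be the graph on $\mathcal C_3$ in which $g,g'$ are adjacent if and only if $g'g^{ -1}\in\mathcal C_3$. Let $N$ be the set of neighbours of $h$ in $\Gamma$ other than $h^{ -1}$. Then for every $U\in N$ and every $i\in\{1,2\}$, the vertices $U$ and $h^iUh^{ -i}$ are not adjacent in $\Gamma$. -}

module Defs where

open import Level using (Level; _⊔_)
open import Algebra.Bundles using (CommutativeRing)
open import Data.Nat using (ℕ; zero; suc)
open import Data.Fin using (Fin)
open import Data.Product using (_×_; ∃)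
open import Data.Sum using (_⊎_)
open import Relation.Nullary using (¬_)
open import Function.Bundles using (Bijection)
import Relation.Binary.PropositionalEquality as ≡

record IsField {c ℓ : Level} (R : CommutativeRing c ℓ) : Set (c ⊔ ℓ) where
  open CommutativeRing R
  field
    0≉1     : ¬ (0# ≈ 1#)
    inverse : ∀ x → ¬ (x ≈ 0#) → ∃ λ y → x * y ≈ 1#

HasCard : {c ℓ : Level} → CommutativeRing c ℓ → ℕ → Set (c ⊔ ℓ)
HasCard R q = Bijection (≡.setoid (Fin q)) (CommutativeRing.setoid R)

-- 2×2 matrices over R, and the group PSL(2,R) realised as SL(2,R) modulo ±I.
module Matrices {c ℓ : Level} (R : CommutativeRing c ℓ) where
  open CommutativeRing R

  record Mat : Set c where
    constructor mat
    field
      a b c' d : Carrier   -- the matrix [[a , b] , [c' , d]]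
  open Mat public

  infixl 7 _·_
  _·_ : Mat → Mat → Mat
  A · B = mat (a A * a B + b A * c' B) (a A * b B + b A * d B)
              (c' A * a B + d A * c' B) (c' A * b B + d A * d B)

  I : Mat
  I = mat 1# 0# 0# 1#

  negM : Mat → Mat
  negM A = mat (- a A) (- b A) (- c' A) (- d A)

  det : Mat → Carrier
  det A = a A * d A - b A * c' A

  -- inverse of a matrix of determinant 1 (the adjugate)
  inv : Mat → Mat
  inv A = mat (d A) (- b A) (- c' A) (a A)

  pow : Mat → ℕ → Mat
  pow A zero = I
  pow A (suc n) = A · pow A n

  _≈M_ : Mat → Mat → Set ℓ
  A ≈M B = (a A ≈ a B) × (b A ≈ b B) × (c' A ≈ c' B) × (d A ≈ d B)

  _∼P_ : Mat → Mat → Set ℓ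
  A ∼P B = A ≈M B ⊎ A ≈M negM B

  InSL : Mat → Set ℓ
  InSL A = det A ≈ 1#

  -- the image of A ∈ SL(2,R) has order 3 in PSL(2,R)  (3 is prime)
  Order3 : Mat → Set ℓ
  Order3 A = ¬ (A ∼P I) × (pow A 3 ∼P I)

  InC3 : Mat → Set ℓ
  InC3 A = InSL A × Order3 A

  Adj : Mat → Mat → Set ℓ
  Adj g g' = Order3 (g' · inv g)

  h : Mat
  h = mat 0# (- 1#) 1# (- 1#)

-- An element A ∈ SL(2,F) whose image in PSL(2,F) has order 3 satisfies (tr A)² = 1: by
-- Cayley–Hamilton A³ = ((tr A)² − det A) A − (tr A)(det A) I, so if (tr A)² ≠ 1 then A³ = ±I
-- forces A = ±I.  Put s = tr U and t = tr (U h⁻¹).  For i = 1, 2 the commutator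
-- hⁱ U h⁻ⁱ U⁻¹ has trace s² + t² + st − 1, so if U were adjacent to hⁱ U h⁻ⁱ then s² = t² = 1
-- and (1 + st)² = 1, which forces 3 = 0 in F.  But |F| = q gives q · 1 = 0, and q ≡ 2 (mod 3)
-- rules out characteristic 3.
module Submission where

open import Defs
open import Level using (Level)
open import Algebra.Bundles using (CommutativeRing)
open import Data.Nat using (ℕ; suc; _≤_; _^_; _%_)
open import Data.Nat.Primality using (Prime)
open import Data.Product using (_×_; ∃₂)
open import Relation.Nullary using (¬_)
open import Relation.Binary.PropositionalEquality using (_≡_)

open import Algebra.Solver.Ring.AlmostCommutativeRing
  using (fromCommutativeRing; _-Raw-AlmostCommutative⟶_)
open import Data.Empty using (⊥-elim)
import Data.Fin as Fin
open import Data.Fin.Permutation using (Permutation; permutation; _⟨$⟩ʳ_)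
open import Data.Integer as ℤ using (ℤ; +_; -[1+_]; _⊖_)
import Data.Integer.Properties as ℤ
open import Data.Maybe as Maybe using (Maybe)
open import Data.Nat as ℕ using (zero; s≤s)
import Data.Nat.Properties as ℕ
open import Data.Nat.DivMod using (_/_; m≡m%n+[m/n]*n)
open import Data.Product using (_,_)
open import Data.Sum using (_⊎_; inj₁; inj₂)
open import Function using (_∘_)
open import Function.Bundles using (Bijection; Surjection)
open import Function.Properties.Surjection using (injective⇒to⁻-cong)
open import Relation.Binary.Definitions using (Decidable)
import Relation.Binary.PropositionalEquality as ≡
open import Relation.Nullary using (yes; no)
import Relation.Nullary.Decidable as Dec

-- With the type-checking-optimised _×′_, fromℤ (+ 0) and fromℤ (+ 1) reduce to 0# and 1#,
-- so the constants of solver goals are literally 0#, 1#, 1# + 1# + 1#, … in the ring.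
module IntegerCoefficients {c ℓ : Level} (R : CommutativeRing c ℓ) where
  open CommutativeRing R
  open import Algebra.Properties.Ring ring
    using (-0#≈0#; -‿involutive; -‿+-comm; -‿distribˡ-*; -‿distribʳ-*)
  open import Algebra.Properties.Semiring.Mult.TCOptimised semiring
    using (1+×; ×-homo-+; ×1-homo-*) renaming (_×_ to _×′_)
  open import Algebra.Properties.CommutativeSemigroup +-commutativeSemigroup
    using () renaming (interchange to +-interchange)
  open import Relation.Binary.Reasoning.Setoid setoid

  fromℤ : ℤ → Carrier
  fromℤ (+ n)    = n ×′ 1#
  fromℤ -[1+ n ] = - (suc n ×′ 1#)

  fromℤ-⊖ : ∀ m n → fromℤ (m ⊖ n) ≈ m ×′ 1# - n ×′ 1#
  fromℤ-⊖ m zero = begin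
    m ×′ 1#       ≈⟨ +-identityʳ _ ⟨
    m ×′ 1# + 0#  ≈⟨ +-congˡ -0#≈0# ⟨
    m ×′ 1# - 0#  ∎
  fromℤ-⊖ zero (suc n) = sym (+-identityˡ _)
  fromℤ-⊖ (suc m) (suc n) = begin
    fromℤ (suc m ⊖ suc n)               ≡⟨ ≡.cong fromℤ (ℤ.[1+m]⊖[1+n]≡m⊖n m n) ⟩
    fromℤ (m ⊖ n)                       ≈⟨ fromℤ-⊖ m n ⟩
    m ×′ 1# - n ×′ 1#                   ≈⟨ +-identityˡ _ ⟨
    0# + (m ×′ 1# - n ×′ 1#)            ≈⟨ +-congʳ (-‿inverseʳ 1#) ⟨
    (1# - 1#) + (m ×′ 1# - n ×′ 1#)     ≈⟨ +-interchange _ _ _ _ ⟩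
    (1# + m ×′ 1#) + (- 1# - n ×′ 1#)   ≈⟨ +-cong (sym (1+× m 1#)) (-‿+-comm 1# (n ×′ 1#)) ⟩
    suc m ×′ 1# - (1# + n ×′ 1#)        ≈⟨ +-congˡ (-‿cong (1+× n 1#)) ⟨
    suc m ×′ 1# - suc n ×′ 1#           ∎

  fromℤ-+ : ∀ i j → fromℤ (i ℤ.+ j) ≈ fromℤ i + fromℤ j
  fromℤ-+ (+ m)    (+ n)    = ×-homo-+ 1# m n
  fromℤ-+ (+ m)    -[1+ n ] = fromℤ-⊖ m (suc n)
  fromℤ-+ -[1+ m ] (+ n)    = trans (fromℤ-⊖ n (suc m)) (+-comm _ _)
  fromℤ-+ -[1+ m ] -[1+ n ] = begin
    - (suc (suc (m ℕ.+ n)) ×′ 1#)     ≡⟨ ≡.cong (λ k → - (suc k ×′ 1#)) (ℕ.+-suc m n) ⟨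
    - ((suc m ℕ.+ suc n) ×′ 1#)       ≈⟨ -‿cong (×-homo-+ 1# (suc m) (suc n)) ⟩
    - (suc m ×′ 1# + suc n ×′ 1#)     ≈⟨ -‿+-comm _ _ ⟨
    - (suc m ×′ 1#) - suc n ×′ 1#     ∎

  fromℤ-neg : ∀ i → fromℤ (ℤ.- i) ≈ - fromℤ i
  fromℤ-neg (+ zero)  = sym -0#≈0#
  fromℤ-neg (+ suc n) = refl
  fromℤ-neg -[1+ n ]  = sym (-‿involutive _)

  fromℤ-*-pos : ∀ m n → fromℤ (+ m ℤ.* + n) ≈ fromℤ (+ m) * fromℤ (+ n)
  fromℤ-*-pos m n = begin
    fromℤ (+ m ℤ.* + n)    ≡⟨ ≡.cong fromℤ (ℤ.pos-* m n) ⟨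
    (m ℕ.* n) ×′ 1#        ≈⟨ ×1-homo-* m n ⟩
    m ×′ 1# * n ×′ 1#      ∎

  fromℤ-* : ∀ i j → fromℤ (i ℤ.* j) ≈ fromℤ i * fromℤ j
  fromℤ-* (+ m) (+ n) = fromℤ-*-pos m n
  fromℤ-* (+ m) -[1+ n ] = begin
    fromℤ (+ m ℤ.* ℤ.- + suc n)     ≡⟨ ≡.cong fromℤ (ℤ.neg-distribʳ-* (+ m) (+ suc n)) ⟨
    fromℤ (ℤ.- (+ m ℤ.* + suc n))   ≈⟨ fromℤ-neg (+ m ℤ.* + suc n) ⟩
    - fromℤ (+ m ℤ.* + suc n)       ≈⟨ -‿cong (fromℤ-*-pos m (suc n)) ⟩
    - (m ×′ 1# * suc n ×′ 1#)       ≈⟨ -‿distribʳ-* _ _ ⟩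
    m ×′ 1# * - (suc n ×′ 1#)       ∎
  fromℤ-* -[1+ m ] (+ n) = begin
    fromℤ (ℤ.- + suc m ℤ.* + n)     ≡⟨ ≡.cong fromℤ (ℤ.neg-distribˡ-* (+ suc m) (+ n)) ⟨
    fromℤ (ℤ.- (+ suc m ℤ.* + n))   ≈⟨ fromℤ-neg (+ suc m ℤ.* + n) ⟩
    - fromℤ (+ suc m ℤ.* + n)       ≈⟨ -‿cong (fromℤ-*-pos (suc m) n) ⟩
    - (suc m ×′ 1# * n ×′ 1#)       ≈⟨ -‿distribˡ-* _ _ ⟩
    - (suc m ×′ 1#) * n ×′ 1#       ∎
  fromℤ-* -[1+ m ] -[1+ n ] = begin
    fromℤ (+ suc m ℤ.* + suc n)        ≈⟨ fromℤ-*-pos (suc m) (suc n) ⟩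
    suc m ×′ 1# * suc n ×′ 1#          ≈⟨ -‿involutive _ ⟨
    - - (suc m ×′ 1# * suc n ×′ 1#)    ≈⟨ -‿cong (-‿distribˡ-* _ _) ⟩
    - (- (suc m ×′ 1#) * suc n ×′ 1#)  ≈⟨ -‿distribʳ-* _ _ ⟩
    - (suc m ×′ 1#) * - (suc n ×′ 1#)  ∎

  fromℤ-homomorphism : ℤ.+-*-rawRing -Raw-AlmostCommutative⟶ fromCommutativeRing R
  fromℤ-homomorphism = record
    { ⟦_⟧    = fromℤ
    ; +-homo = fromℤ-+
    ; *-homo = fromℤ-*
    ; -‿homo = fromℤ-neg
    ; 0-homo = refl
    ; 1-homo = refl
    }

  fromℤ-≈? : ∀ i j → Maybe (fromℤ i ≈ fromℤ j)
  fromℤ-≈? i j = Maybe.map (λ { ≡.refl → refl }) (Dec.dec⇒maybe (i ℤ.≟ j))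

  open import Algebra.Solver.Ring ℤ.+-*-rawRing (fromCommutativeRing R) fromℤ-homomorphism fromℤ-≈? public

-- A copy of Matrices over solver polynomials whose semantics agrees definitionally with
-- Matrices, so that each identity between matrix expressions is a single call to solve.
module PolynomialMatrices {c ℓ : Level} (R : CommutativeRing c ℓ) where
  open IntegerCoefficients R using (Polynomial; con; _:+_; _:*_; _:-_; :-_)

  record Mat (n : ℕ) : Set c where
    constructor mat
    field a b c' d : Polynomial n
  open Mat public

  module _ {n : ℕ} where
    infixl 7 _·_
    _·_ : Mat n → Mat n → Mat n
    A · B = mat (a A :* a B :+ b A :* c' B) (a A :* b B :+ b A :* d B)
                (c' A :* a B :+ d A :* c' B) (c' A :* b B :+ d A :* d B)

    I : Mat n
    I = mat (con (+ 1)) (con (+ 0)) (con (+ 0)) (con (+ 1))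

    inv : Mat n → Mat n
    inv A = mat (d A) (:- b A) (:- c' A) (a A)

    pow : Mat n → ℕ → Mat n
    pow A zero    = I
    pow A (suc k) = A · pow A k

    h : Mat n
    h = mat (con (+ 0)) (:- con (+ 1)) (con (+ 1)) (:- con (+ 1))

    det : Mat n → Polynomial n
    det A = a A :* d A :- b A :* c' A

    tr : Mat n → Polynomial n
    tr A = a A :+ d A

module MatrixAlgebra {c ℓ : Level} (R : CommutativeRing c ℓ) where
  open CommutativeRing R
  open import Algebra.Properties.Ring ring using (-0#≈0#)
  open IntegerCoefficients R
  open Matrices R
  module P = PolynomialMatrices R

  tr : Mat → Carrier
  tr A = a A + d A

  det-· : ∀ A B → det (A · B) ≈ det A * det B
  det-· (mat x y z w) (mat x' y' z' w') = solve 8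
    (λ x y z w x' y' z' w' → let A = P.mat x y z w ; B = P.mat x' y' z' w' in
       P.det (A P.· B) := P.det A :* P.det B) refl x y z w x' y' z' w'

  det-inv : ∀ A → det (inv A) ≈ det A
  det-inv (mat x y z w) = solve 4
    (λ x y z w → let A = P.mat x y z w in P.det (P.inv A) := P.det A) refl x y z w

  InSL-I : InSL I
  InSL-I = solve 0 (P.det P.I := con (+ 1)) refl

  InSL-h : InSL h
  InSL-h = solve 0 (P.det P.h := con (+ 1)) refl

  InSL-· : ∀ {A B} → InSL A → InSL B → InSL (A · B)
  InSL-· {A} {B} detA≈1 detB≈1 = trans (det-· A B) (trans (*-cong detA≈1 detB≈1) (*-identityˡ 1#))

  InSL-inv : ∀ {A} → InSL A → InSL (inv A)
  InSL-inv {A} = trans (det-inv A)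

  InSL-pow : ∀ {A} → InSL A → ∀ n → InSL (pow A n)
  InSL-pow A∈SL zero    = InSL-I
  InSL-pow A∈SL (suc n) = InSL-· A∈SL (InSL-pow A∈SL n)

  Scalar : Mat → Set ℓ
  Scalar A = b A ≈ 0# × c' A ≈ 0# × a A ≈ d A

  ∼P-I⇒Scalar : ∀ {A} → A ∼P I → Scalar A
  ∼P-I⇒Scalar (inj₁ (a≈1 , b≈0 , c≈0 , d≈1)) = b≈0 , c≈0 , trans a≈1 (sym d≈1)
  ∼P-I⇒Scalar (inj₂ (a≈-1 , b≈-0 , c≈-0 , d≈-1)) =
    trans b≈-0 -0#≈0# , trans c≈-0 -0#≈0# , trans a≈-1 (sym d≈-1)

  -- The off-scalar part of Cayley–Hamilton A³ = ((tr A)² − det A) A − (tr A)(det A) I.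
  b-pow3 : ∀ A → b (pow A 3) ≈ (tr A * tr A - det A) * b A
  b-pow3 (mat x y z w) = solve 4
    (λ x y z w → let A = P.mat x y z w in
       P.b (P.pow A 3) := (P.tr A :* P.tr A :- P.det A) :* y) refl x y z w

  c'-pow3 : ∀ A → c' (pow A 3) ≈ (tr A * tr A - det A) * c' A
  c'-pow3 (mat x y z w) = solve 4
    (λ x y z w → let A = P.mat x y z w in
       P.c' (P.pow A 3) := (P.tr A :* P.tr A :- P.det A) :* z) refl x y z w

  a-d-pow3 : ∀ A → a (pow A 3) - d (pow A 3) ≈ (tr A * tr A - det A) * (a A - d A)
  a-d-pow3 (mat x y z w) = solve 4
    (λ x y z w → let A = P.mat x y z w in
       P.a (P.pow A 3) :- P.d (P.pow A 3) := (P.tr A :* P.tr A :- P.det A) :* (x :- w)) refl x y z w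

  -- Fricke's identity tr [B , A] = (tr B)² + (tr A)² + (tr BA)² − tr B tr A tr BA − 2 for
  -- B = hⁱ, where tr hⁱ = −1, and tr (h A) = − s − t, tr (h² A) = t because h + h⁻¹ = − I.
  tr-commutator-hⁱ : ∀ {i A} → 1 ≤ i → i ≤ 2 → InSL A → let s = tr A ; t = tr (A · inv h) in
    tr (pow h i · A · inv (pow h i) · inv A) ≈ s * s + t * t + s * t - 1#
  tr-commutator-hⁱ {A = A} 1≤i i≤2 detA≈1 = trans (tr-formula 1≤i i≤2 A) (+-congˡ (-‿cong detA≈1))
    where
    formula : ∀ {k} j → Polynomial k → Polynomial k → Polynomial k → Polynomial k →
              Polynomial k × Polynomial k
    formula j x y z w = let A = P.mat x y z w ; s = P.tr A ; t = P.tr (A P.· P.inv P.h) in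
      P.tr (P.pow P.h j P.· A P.· P.inv (P.pow P.h j) P.· P.inv A) := s :* s :+ t :* t :+ s :* t :- P.det A

    tr-formula : ∀ {i} → 1 ≤ i → i ≤ 2 → ∀ A → let s = tr A ; t = tr (A · inv h) in
      tr (pow h i · A · inv (pow h i) · inv A) ≈ s * s + t * t + s * t - det A
    tr-formula {1} _ _ (mat x y z w) = solve 4 (formula 1) refl x y z w
    tr-formula {2} _ _ (mat x y z w) = solve 4 (formula 2) refl x y z w
    tr-formula {suc (suc (suc _))} _ (s≤s (s≤s ()))

module Characteristic3 {c ℓ : Level} (R : CommutativeRing c ℓ) where
  open CommutativeRing R
  open IntegerCoefficients R
  open import Algebra.Properties.Ring ring using (x≈y⇒x∙y⁻¹≈ε)
  open import Algebra.Properties.Semiring.Mult.TCOptimised semiring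
    using (×-homo-+; ×1-homo-*) renaming (_×_ to _×′_)
  open import Algebra.Properties.CommutativeSemigroup *-commutativeSemigroup
    using () renaming (interchange to *-interchange)
  open import Relation.Binary.Reasoning.Setoid setoid

  x²≈1∧[1+x]²≈1⇒3≈0 : ∀ x → x * x ≈ 1# → (1# + x) * (1# + x) ≈ 1# → 3 ×′ 1# ≈ 0#
  x²≈1∧[1+x]²≈1⇒3≈0 x x²≈1 [1+x]²≈1 = begin
    3 ×′ 1#                                                                      ≈⟨ combination x ⟩
    (x + x - 1#) * ((1# + x) * (1# + x) - 1#) - (x + x + 3 ×′ 1#) * (x * x - 1#)
      ≈⟨ +-cong (*-congˡ (x≈y⇒x∙y⁻¹≈ε [1+x]²≈1)) (-‿cong (*-congˡ (x≈y⇒x∙y⁻¹≈ε x²≈1))) ⟩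
    (x + x - 1#) * 0# - (x + x + 3 ×′ 1#) * 0#   ≈⟨ +-cong (zeroʳ _) (-‿cong (zeroʳ _)) ⟩
    0# - 0#                                      ≈⟨ -‿inverseʳ 0# ⟩
    0#                                           ∎
    where
    combination : ∀ x → 3 ×′ 1# ≈ (x + x - 1#) * ((1# + x) * (1# + x) - 1#) - (x + x + 3 ×′ 1#) * (x * x - 1#)
    combination = solve 1 (λ x → con (+ 3) :=
      (x :+ x :- con (+ 1)) :* ((con (+ 1) :+ x) :* (con (+ 1) :+ x) :- con (+ 1))
        :- (x :+ x :+ con (+ 3)) :* (x :* x :- con (+ 1))) refl

  squares≈1⇒3≈0 : ∀ {x y z} → x * x ≈ 1# → y * y ≈ 1# → z ≈ x * x + y * y + x * y - 1# → z * z ≈ 1# →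
                  3 ×′ 1# ≈ 0#
  squares≈1⇒3≈0 {x} {y} {z} x²≈1 y²≈1 z≈ z²≈1 =
    x²≈1∧[1+x]²≈1⇒3≈0 (x * y) [xy]²≈1 (trans (*-cong (sym z≈1+xy) (sym z≈1+xy)) z²≈1)
    where
    [xy]²≈1 : (x * y) * (x * y) ≈ 1#
    [xy]²≈1 = trans (*-interchange x y x y) (trans (*-cong x²≈1 y²≈1) (*-identityˡ 1#))

    1+1+u-1≈1+u : ∀ u → 1# + 1# + u - 1# ≈ 1# + u
    1+1+u-1≈1+u = solve 1 (λ u → con (+ 1) :+ con (+ 1) :+ u :- con (+ 1) := con (+ 1) :+ u) refl

    z≈1+xy : z ≈ 1# + x * y
    z≈1+xy = trans z≈ (trans (+-congʳ (+-congʳ (+-cong x²≈1 y²≈1))) (1+1+u-1≈1+u (x * y)))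

  q×1≈0∧q%3≡2⇒3≉0 : ∀ q → ¬ (0# ≈ 1#) → q ×′ 1# ≈ 0# → q % 3 ≡ 2 → ¬ (3 ×′ 1# ≈ 0#)
  q×1≈0∧q%3≡2⇒3≉0 q 0≉1 q×1≈0 q%3≡2 3≈0 = 0≉1 (begin
    0#              ≈⟨ 3≈0 ⟨
    2 ×′ 1# + 1#    ≈⟨ +-congʳ 2≈0 ⟩
    0# + 1#         ≈⟨ +-identityˡ 1# ⟩
    1#              ∎)
    where
    k = q / 3
    2≈0 : 2 ×′ 1# ≈ 0#
    2≈0 = begin
      2 ×′ 1#                      ≈⟨ +-identityʳ _ ⟨
      2 ×′ 1# + 0#                 ≈⟨ +-congˡ (zeroʳ (k ×′ 1#)) ⟨
      2 ×′ 1# + k ×′ 1# * 0#       ≈⟨ +-congˡ (*-congˡ 3≈0) ⟨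
      2 ×′ 1# + k ×′ 1# * 3 ×′ 1#  ≈⟨ +-congˡ (×1-homo-* k 3) ⟨
      2 ×′ 1# + (k ℕ.* 3) ×′ 1#    ≈⟨ ×-homo-+ 1# 2 (k ℕ.* 3) ⟨
      (2 ℕ.+ k ℕ.* 3) ×′ 1#        ≡⟨ ≡.cong (λ r → (r ℕ.+ k ℕ.* 3) ×′ 1#) q%3≡2 ⟨
      (q % 3 ℕ.+ k ℕ.* 3) ×′ 1#    ≡⟨ ≡.cong (_×′ 1#) (m≡m%n+[m/n]*n q 3) ⟨
      q ×′ 1#                      ≈⟨ q×1≈0 ⟩
      0#                           ∎

module FiniteRing {c ℓ : Level} (R : CommutativeRing c ℓ) {q : ℕ} (card : HasCard R q) where
  open CommutativeRing R
  open import Algebra.Properties.Ring ring using (//-rightDividesˡ; //-rightDividesʳ; +-identityʳ-unique)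
  open import Algebra.Properties.Semiring.Mult.TCOptimised semiring using (×ᵤ≈×) renaming (_×_ to _×′_)
  open import Algebra.Properties.CommutativeMonoid.Sum +-commutativeMonoid
    using (sum; sum-permute; sum-cong-≋; ∑-distrib-+; sum-replicate)
  open import Relation.Binary.Reasoning.Setoid setoid
  open Bijection card using (to; injective; to⁻)
  open Surjection (Bijection.surjection card) using (to∘to⁻)

  infix 4 _≟_
  _≟_ : Decidable _≈_
  x ≟ y = Dec.map′ to⁻-injective (injective⇒to⁻-cong (Bijection.surjection card) injective)
                   (to⁻ x Fin.≟ to⁻ y)
    where
    to⁻-injective : to⁻ x ≡ to⁻ y → x ≈ y
    to⁻-injective eq = trans (sym (to∘to⁻ x)) (trans (reflexive (≡.cong to eq)) (to∘to⁻ y))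

  +1-permutation : Permutation q q
  +1-permutation = permutation (λ i → to⁻ (to i + 1#)) (λ i → to⁻ (to i - 1#))
    (λ i → injective (trans (to∘to⁻ _) (trans (+-congʳ (to∘to⁻ _)) (//-rightDividesˡ 1# (to i)))))
    (λ i → injective (trans (to∘to⁻ _) (trans (+-congʳ (to∘to⁻ _)) (//-rightDividesʳ 1# (to i)))))

  q×1≈0 : q ×′ 1# ≈ 0#
  q×1≈0 = +-identityʳ-unique (sum to) (q ×′ 1#) (begin
    sum to + q ×′ 1#                        ≈⟨ +-congˡ (trans (sym (×ᵤ≈× q 1#)) (sym (sum-replicate q))) ⟩
    sum to + sum {q} (λ _ → 1#)             ≈⟨ ∑-distrib-+ to (λ _ → 1#) ⟨
    sum (λ i → to i + 1#)                   ≈⟨ sum-cong-≋ (λ i → to∘to⁻ (to i + 1#)) ⟨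
    sum (λ i → to (+1-permutation ⟨$⟩ʳ i))  ≈⟨ sum-permute to +1-permutation ⟨
    sum to                                  ∎)

module DecidableField {c ℓ : Level} (R : CommutativeRing c ℓ) (F : IsField R)
                      (_≟_ : Decidable (CommutativeRing._≈_ R)) where
  open CommutativeRing R
  open IsField F
  open IntegerCoefficients R
  open Matrices R
  open MatrixAlgebra R
  open import Algebra.Properties.Ring ring using (x≈y⇒x∙y⁻¹≈ε; x∙y⁻¹≈ε⇒x≈y; +-inverseˡ-unique; -0#≈0#)
  open import Relation.Binary.Reasoning.Setoid setoid

  x≉0∧x*y≈0⇒y≈0 : ∀ {x y} → ¬ x ≈ 0# → x * y ≈ 0# → y ≈ 0#
  x≉0∧x*y≈0⇒y≈0 {x} {y} x≉0 xy≈0 with inverse x x≉0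
  ... | x⁻¹ , xx⁻¹≈1 = begin
    y              ≈⟨ *-identityˡ y ⟨
    1# * y         ≈⟨ *-congʳ (trans (sym xx⁻¹≈1) (*-comm x x⁻¹)) ⟩
    (x⁻¹ * x) * y  ≈⟨ *-assoc x⁻¹ x y ⟩
    x⁻¹ * (x * y)  ≈⟨ *-congˡ xy≈0 ⟩
    x⁻¹ * 0#       ≈⟨ zeroʳ x⁻¹ ⟩
    0#             ∎

  x²≈1⇒x≈±1 : ∀ {x} → x * x ≈ 1# → x ≈ 1# ⊎ x ≈ - 1#
  x²≈1⇒x≈±1 {x} x²≈1 with x ≟ 1#
  ... | yes x≈1 = inj₁ x≈1
  ... | no  x≉1 = inj₂ (+-inverseˡ-unique x 1# (x≉0∧x*y≈0⇒y≈0 (x≉1 ∘ x∙y⁻¹≈ε⇒x≈y x 1#) [x-1][x+1]≈0))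
    where
    difference-of-squares : ∀ x → (x - 1#) * (x + 1#) ≈ x * x - 1#
    difference-of-squares = solve 1 (λ x → (x :- con (+ 1)) :* (x :+ con (+ 1)) := x :* x :- con (+ 1)) refl

    [x-1][x+1]≈0 : (x - 1#) * (x + 1#) ≈ 0#
    [x-1][x+1]≈0 = trans (difference-of-squares x) (x≈y⇒x∙y⁻¹≈ε x²≈1)

  Scalar∧InSL⇒∼P-I : ∀ {A} → Scalar A → InSL A → A ∼P I
  Scalar∧InSL⇒∼P-I {A} (b≈0 , c≈0 , a≈d) detA≈1 with x²≈1⇒x≈±1 a²≈1
    where
    a²≈1 : a A * a A ≈ 1#
    a²≈1 = begin
      a A * a A              ≈⟨ *-congˡ a≈d ⟩
      a A * d A              ≈⟨ +-identityʳ _ ⟨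
      a A * d A + 0#         ≈⟨ +-congˡ -0#≈0# ⟨
      a A * d A - 0#         ≈⟨ +-congˡ (-‿cong (trans (*-congʳ b≈0) (zeroˡ (c' A)))) ⟨
      a A * d A - b A * c' A ≈⟨ detA≈1 ⟩
      1#                     ∎
  ... | inj₁ a≈1  = inj₁ (a≈1 , b≈0 , c≈0 , trans (sym a≈d) a≈1)
  ... | inj₂ a≈-1 = inj₂ (a≈-1 , trans b≈0 (sym -0#≈0#) , trans c≈0 (sym -0#≈0#) , trans (sym a≈d) a≈-1)

  Scalar-pow3⇒Scalar : ∀ {A} → ¬ (tr A * tr A - det A ≈ 0#) → Scalar (pow A 3) → Scalar A
  Scalar-pow3⇒Scalar {A} m≉0 (b³≈0 , c³≈0 , a³≈d³) =
    x≉0∧x*y≈0⇒y≈0 m≉0 (trans (sym (b-pow3 A)) b³≈0) ,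
    x≉0∧x*y≈0⇒y≈0 m≉0 (trans (sym (c'-pow3 A)) c³≈0) ,
    x∙y⁻¹≈ε⇒x≈y _ _ (x≉0∧x*y≈0⇒y≈0 m≉0 (trans (sym (a-d-pow3 A)) (x≈y⇒x∙y⁻¹≈ε a³≈d³)))

  order3⇒tr²≈1 : ∀ {A} → InSL A → Order3 A → tr A * tr A ≈ 1#
  order3⇒tr²≈1 {A} detA≈1 (A≁I , A³∼I) with (tr A * tr A) ≟ 1#
  ... | yes tr²≈1 = tr²≈1
  ... | no  tr²≉1 = ⊥-elim (A≁I (Scalar∧InSL⇒∼P-I (Scalar-pow3⇒Scalar tr²≉det (∼P-I⇒Scalar A³∼I)) detA≈1))
    where
    tr²≉det : ¬ (tr A * tr A - det A ≈ 0#)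
    tr²≉det tr²-det≈0 = tr²≉1 (trans (x∙y⁻¹≈ε⇒x≈y _ _ tr²-det≈0) detA≈1)

lemma6p2 : ∀ {c ℓ : Level} (q : ℕ) →
    (∃₂ λ p k → Prime p × q ≡ p ^ suc k) → q % 2 ≡ 1 → q % 3 ≡ 2 →
    (R : CommutativeRing c ℓ) → IsField R → HasCard R q →
    let open Matrices R in
    (U : Mat) → InC3 U → Adj h U → ¬ (U ∼P inv h) →
    (i : ℕ) → 1 ≤ i → i ≤ 2 →
    ¬ Adj U (pow h i · U · inv (pow h i))
lemma6p2 q _ _ q%3≡2 R F card U (U∈SL , U-order3) h~U _ i 1≤i i≤2 U~X =
  q×1≈0∧q%3≡2⇒3≉0 q (IsField.0≉1 F) q×1≈0 q%3≡2
    (squares≈1⇒3≈0 (order3⇒tr²≈1 U∈SL U-order3)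
                   (order3⇒tr²≈1 (InSL-· U∈SL (InSL-inv InSL-h)) h~U)
                   (tr-commutator-hⁱ 1≤i i≤2 U∈SL)
                   (order3⇒tr²≈1 X∈SL U~X))
  where
  open Matrices R
  open MatrixAlgebra R
  open Characteristic3 R
  open FiniteRing R card
  open DecidableField R F _≟_
  hⁱ∈SL = InSL-pow InSL-h i
  X∈SL = InSL-· (InSL-· (InSL-· hⁱ∈SL U∈SL) (InSL-inv hⁱ∈SL)) (InSL-inv U∈SL)
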